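{- (Duality Formula) For every nonzero $\mu\in\widetilde{\mathcal E}$, $z\big(\sum\mu\widetilde H\big)=\sum\bar\mu H$.
   Context: A coefficient function is a sequence $\mu=(\mu_1,\mu_2,\dots)$ of non-negative integers; it has finite support if only finitely many $\mu_k$ are nonzero. For a sequence $G$, $\sum\mu G:=\sum_{k\ge1}\mu_kG_k$. For $n\ge1$, $\mathrm{rev}_n(\mu)=(\mu_n,\mu_{n-1},\dots,\mu_1,0,0,\dots)$. For finite-support $\mu\ne\mu'$, $\mu<_a\mu'$ means $\mu_k<\mu'_k$ for the largest $k$ with $\mu_k\ne\mu'_k$. For a list $L=(e_1,\dots,e_N)$ of non-negative integers with $N\ge2$, $e_1\ne0$, let $\beta^*$ be the coefficient function with $\beta^*_k=e_j$ whenever $k\equiv j\pmod N$, $1\le j\le N$; for $n\ge2$ let $\theta^n=\mathrm{rev}_{n-1}(\beta^*)$ (the maximal $L$-block at index $n-1$, support interval $[1,n-1]$). A proper $L$-block at index $n-1$ ($n\ge2$) is a coefficient function $\zeta$ such that for some $k\in[1,n-1]$: $\zeta_j=\theta^n_j$ for $j>k$, $\zeta_k<\theta^n_k$, $\zeta_j=0$ for $j<k$; its support interval is $[k,n-1]$. The periodic Zeckendorf collection for positive integers determined by $L$ is the set of all finite sums (including $0$) of $L$-blocks with pairwise disjoint support intervals. Its fundamental sequence $H$ is given by $H_1=1$, $H_n=1+\sum\theta^nH$ ($n\ge2$); $\epsilon\mapsto\sum\epsilon H$ is a bijection from the collection onto $\mathbb Z_{\ge0}$, strictly increasing for $<_a$.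 Let $\mathcal E\subsetneq\widetilde{\mathcal E}$ be the periodic Zeckendorf collections for positive integers determined by two such lists $L$ and $\widetilde L$, with fundamental sequences $H$ and $\widetilde H$. For a positive integer $x$, $z(x)$ is the number of integers $n$ with $0\le n<x$ such that $n=\sum\epsilon\widetilde H$ for some $\epsilon\in\mathcal E$. For nonzero finite-support $\mu$, $\check\mu$ is the $<_a$-largest element of $\mathcal E$ that is $<_a\mu$, and $\bar\mu$ is the $<_a$-smallest element of $\mathcal E$ that is $>_a\check\mu$. -}

module Defs where

open import Data.Nat using (ℕ; zero; suc; _+_; _*_; _∸_; _≤_; _<_; _%_; _<ᵇ_)
open import Data.Bool using (if_then_else_)
open import Data.List using (List; []; _∷_; length; map)
open import Data.Nat.ListAction using (sum)
open import Data.List.Relation.Unary.All using (All)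
open import Data.List.Relation.Unary.AllPairs using (AllPairs)
open import Data.List.Relation.Unary.Unique.Propositional using (Unique)
open import Data.List.Membership.Propositional using (_∈_)
open import Data.Product using (Σ; ∃; _×_; _,_)
open import Data.Sum using (_⊎_)
open import Relation.Nullary using (¬_)
open import Relation.Binary.PropositionalEquality using (_≡_; _≢_)

-- CONVENTION: 0-based indexing.
-- A coefficient function μ = (μ₁, μ₂, …) is represented by
-- μ : ℕ → ℕ with  μ i = μ_{i+1}.  Likewise a sequence G has G i = G_{i+1}.

CoeffFun : Set
CoeffFun = ℕ → ℕ

sumTo : ℕ → CoeffFun → (ℕ → ℕ) → ℕ
sumTo zero    μ G = 0
sumTo (suc N) μ G = sumTo N μ G + μ N * G N

SupportBelow : ℕ → CoeffFun → Set
SupportBelow N μ = ∀ i → N ≤ i → μ i ≡ 0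

ValidList : List ℕ → Set
ValidList []       = ¬ (0 ≡ 0)
ValidList (e ∷ es) = (e ≢ 0) × (1 ≤ length es)

nth0 : List ℕ → ℕ → ℕ
nth0 []       _       = 0
nth0 (x ∷ xs) zero    = x
nth0 (x ∷ xs) (suc i) = nth0 xs i

-- β* in 0-based form: beta L i = β*_{i+1} = e_j with i+1 ≡ j (mod N), 1 ≤ j ≤ N.
beta : List ℕ → CoeffFun
beta []       i = 0
beta (e ∷ es) i = nth0 (e ∷ es) (i % suc (length es))

-- θ at (paper) index m = n-1 ≥ 1, i.e. θ^{m+1} = rev_m(β*):
--   θ^{m+1}_k = β*_{m+1-k} for 1 ≤ k ≤ m, and 0 otherwise.
-- 0-based: theta L m p = β*_{m-p} = beta L (m ∸ suc p) for p < m.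
theta : List ℕ → ℕ → CoeffFun
theta L m p = if p <ᵇ m then beta L (m ∸ suc p) else 0

-- ζ is an L-block with support interval [a+1, b+1] (paper indexing),
-- i.e. 0-based positions [a, b]; its (paper) index is b+1 =: m ≥ 1.
data IsBlock (L : List ℕ) (ζ : CoeffFun) : ℕ → ℕ → Set where
  maximal : ∀ {b} → (∀ i → ζ i ≡ theta L (suc b) i) → IsBlock L ζ 0 b
  proper  : ∀ {a b} → a ≤ b
          → (∀ j → a < j → ζ j ≡ theta L (suc b) j)
          → ζ a < theta L (suc b) a
          → (∀ j → j < a → ζ j ≡ 0)
          → IsBlock L ζ a b

-- a block together with its (0-based) support interval [a, b]
Blk : Set
Blk = CoeffFun × ℕ × ℕ

ValidBlk : List ℕ → Blk → Set
ValidBlk L (ζ , a , b) = IsBlock L ζ a b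

DisjointBlk : Blk → Blk → Set
DisjointBlk (_ , a₁ , b₁) (_ , a₂ , b₂) = (b₁ < a₂) ⊎ (b₂ < a₁)

blkAt : ℕ → Blk → ℕ
blkAt i (ζ , _ , _) = ζ i

-- μ belongs to the periodic Zeckendorf collection determined by L:
-- μ is (pointwise) a finite sum of L-blocks with pairwise disjoint support intervals.
InColl : List ℕ → CoeffFun → Set
InColl L μ = Σ (List Blk) λ bs →
  All (ValidBlk L) bs × AllPairs DisjointBlk bs × (∀ i → μ i ≡ sum (map (blkAt i) bs))

-- H is the fundamental sequence of L:  H_1 = 1,  H_n = 1 + Σ θ^n H  (n ≥ 2).
-- 0-based: H 0 = 1 and H m = 1 + Σ_{p<m} θ^{m+1}_p H p for m ≥ 1.
Fundamental : List ℕ → (ℕ → ℕ) → Set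
Fundamental L H = (H 0 ≡ 1) × (∀ m → 1 ≤ m → H m ≡ 1 + sumTo m (theta L m) H)

_<ₐ_ : CoeffFun → CoeffFun → Set
μ <ₐ μ' = ∃ λ k → (μ k < μ' k) × (∀ j → k < j → μ j ≡ μ' j)

IsCheck : List ℕ → CoeffFun → CoeffFun → Set
IsCheck L μ ν = InColl L ν × (ν <ₐ μ) × (∀ ρ → InColl L ρ → ρ <ₐ μ → ¬ (ν <ₐ ρ))

-- ν' = ν̄ (for ν = μ̌) : the <_a-smallest element of the collection that is >_a ν
IsBar : List ℕ → CoeffFun → CoeffFun → Set
IsBar L ν ν' = InColl L ν' × (ν <ₐ ν') × (∀ ρ → InColl L ρ → ν <ₐ ρ → ¬ (ρ <ₐ ν'))

RepBy : List ℕ → (ℕ → ℕ) → ℕ → Set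
RepBy L H̃ n = ∃ λ ε → InColl L ε × ∃ λ K → SupportBelow K ε × (n ≡ sumTo K ε H̃)

CountIs : (ℕ → Set) → ℕ → ℕ → Set
CountIs P x c = Σ (List ℕ) λ xs → Unique xs
  × (∀ n → n ∈ xs → (n < x) × P n)
  × (∀ n → n < x → P n → n ∈ xs)
  × (length xs ≡ c)

{-# OPTIONS --safe #-}
module Submission where

-- Ordered by <ₐ, each collection is order-isomorphic to ℕ through ε ↦ Σ ε H: the value is strictly
-- increasing because blocks are compared from the top, and a greedy choice of blocks reaches every n
-- (Zeckendorf's theorem for L).  Let εₙ be the element of 𝓔 of value n.  As 𝓔 ⊆ 𝓔̃, n ↦ Σ εₙ H̃ is
-- strictly increasing, so for x = Σ μ H̃ > 0 there is a least c ≥ 1 with x ≤ Σ ε_c H̃.  Comparing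
-- values in 𝓔̃, εₙ <ₐ μ exactly when n < c; hence μ̌ = ε_{c-1} and μ̄ = ε_c, whose H-value is c, and
-- the integers below x of the form Σ ε H̃ with ε ∈ 𝓔 are exactly the c numbers Σ εₙ H̃ with n < c.

open import Defs
open import Data.Bool using (true; false)
open import Data.Empty using (⊥; ⊥-elim)
open import Data.List using (List; []; _∷_; map; upTo)
open import Data.List.Membership.Propositional using (_∈_; find; lose)
open import Data.List.Membership.Propositional.Properties using (∈-map⁺; ∈-map⁻; ∈-upTo⁺; ∈-upTo⁻)
open import Data.List.Properties using (length-map; length-upTo)
open import Data.List.Relation.Unary.All as All using (All; []; _∷_)
open import Data.List.Relation.Unary.AllPairs using (AllPairs; []; _∷_)
open import Data.List.Relation.Unary.Any using (here; there; any?)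
import Data.List.Relation.Unary.Unique.Propositional.Properties as Unique
open import Data.Nat using (ℕ; zero; suc; _+_; _*_; _∸_; _≤_; _<_; _%_; _/_; _<ᵇ_; _⊔_; z≤n; s≤s; z<s; NonZero; >-nonZero; ≢-nonZero; _≤?_; _<?_)
open import Data.Nat.DivMod using (m≡m%n+[m/n]*n; m%n<n; m<n*o⇒m/o<n)
open import Data.Nat.Induction using (<-rec)
open import Data.Nat.ListAction using (sum)
open import Data.Nat.Properties
open import Algebra.Properties.CommutativeSemigroup +-commutativeSemigroup using (xy∙z≈xz∙y)
open import Data.Product using (Σ; ∃; _×_; _,_; proj₁; proj₂)
open import Data.Sum using (_⊎_; inj₁; inj₂; swap)
open import Function using (_∘′_)
open import Relation.Binary using (tri<; tri≈; tri>)
open import Relation.Binary.PropositionalEquality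
open import Relation.Nullary using (¬_; yes; no)
open import Relation.Unary using (Decidable)

theta-< : ∀ L {m p} → p < m → theta L m p ≡ beta L (m ∸ suc p)
theta-< L {m} {p} p<m with p <ᵇ m | <⇒<ᵇ p<m
... | true  | _ = refl
... | false | ()

theta-≥ : ∀ L {m p} → m ≤ p → theta L m p ≡ 0
theta-≥ L {m} {p} m≤p with p <ᵇ m | <ᵇ⇒< p m
... | false | _   = refl
... | true  | p<m = ⊥-elim (<⇒≱ (p<m _) m≤p)

theta-last : ∀ L m → theta L (suc m) m ≡ beta L 0
theta-last L m = trans (theta-< L (n<1+n m)) (cong (beta L) (n∸n≡0 m))

beta-head-pos : ∀ {L} → ValidList L → 0 < beta L 0
beta-head-pos {[]}     invalid     = ⊥-elim (invalid refl)
beta-head-pos {_ ∷ _} (e₁≢0 , _) = n≢0⇒n>0 e₁≢0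

sumTo-cong : ∀ t {f g : CoeffFun} {G : ℕ → ℕ} → (∀ j → j < t → f j ≡ g j)
  → sumTo t f G ≡ sumTo t g G
sumTo-cong zero          f≗g = refl
sumTo-cong (suc t) {G = G} f≗g =
  cong₂ _+_ (sumTo-cong t (λ j j<t → f≗g j (m<n⇒m<1+n j<t))) (cong (_* G t) (f≗g t (n<1+n t)))

sumTo-support : ∀ {K} t {f : CoeffFun} {G : ℕ → ℕ} → SupportBelow K f → K ≤ t
  → sumTo t f G ≡ sumTo K f G
sumTo-support {K} t {f} {G} supp K≤t with m≤n⇒m<n∨m≡n K≤t
... | inj₂ refl = refl
sumTo-support {K} (suc t) {f} {G} supp _ | inj₁ K<1+t = begin
  sumTo t f G + f t * G t  ≡⟨ cong (λ x → sumTo t f G + x * G t) (supp t (≤-pred K<1+t)) ⟩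
  sumTo t f G + 0          ≡⟨ +-identityʳ _ ⟩
  sumTo t f G              ≡⟨ sumTo-support t supp (≤-pred K<1+t) ⟩
  sumTo K f G              ∎
  where open ≡-Reasoning

sumTo-bound-irrelevant : ∀ {K K'} {f : CoeffFun} {G : ℕ → ℕ} → SupportBelow K f → SupportBelow K' f
  → sumTo K f G ≡ sumTo K' f G
sumTo-bound-irrelevant {K} {K'} supp supp' =
  trans (sym (sumTo-support (K ⊔ K') supp (m≤m⊔n K K'))) (sumTo-support (K ⊔ K') supp' (m≤n⊔m K K'))

sumTo-agree-above : ∀ {f g : CoeffFun} {G : ℕ → ℕ} k t → k ≤ t → (∀ j → k ≤ j → j < t → f j ≡ g j)
  → sumTo t f G + sumTo k g G ≡ sumTo t g G + sumTo k f G
sumTo-agree-above {f} {g} {G} k t k≤t agree with m≤n⇒m<n∨m≡n k≤t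
... | inj₂ refl = +-comm (sumTo t f G) (sumTo t g G)
sumTo-agree-above {f} {g} {G} k (suc t) _ agree | inj₁ k<1+t = begin
  (sumTo t f G + f t * G t) + sumTo k g G  ≡⟨ xy∙z≈xz∙y (sumTo t f G) _ _ ⟩
  (sumTo t f G + sumTo k g G) + f t * G t  ≡⟨ cong₂ _+_ below (cong (_* G t) (agree t k≤t (n<1+n t))) ⟩
  (sumTo t g G + sumTo k f G) + g t * G t  ≡⟨ xy∙z≈xz∙y (sumTo t g G) _ _ ⟨
  (sumTo t g G + g t * G t) + sumTo k f G  ∎
  where
  open ≡-Reasoning
  k≤t : k ≤ t
  k≤t = ≤-pred k<1+t
  below : sumTo t f G + sumTo k g G ≡ sumTo t g G + sumTo k f G
  below = sumTo-agree-above k t k≤t (λ j k≤j j<t → agree j k≤j (m<n⇒m<1+n j<t))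

sumTo-suc-<⇒sumTo-< : ∀ {f g : CoeffFun} {G : ℕ → ℕ} d t → d < t → (∀ j → d < j → j < t → f j ≡ g j)
  → sumTo (suc d) f G < sumTo (suc d) g G → sumTo t f G < sumTo t g G
sumTo-suc-<⇒sumTo-< {f} {g} {G} d t d<t agree lt =
  +-cancelʳ-< (sumTo (suc d) f G) (sumTo t f G) (sumTo t g G) (begin-strict
    sumTo t f G + sumTo (suc d) f G  <⟨ +-monoʳ-< (sumTo t f G) lt ⟩
    sumTo t f G + sumTo (suc d) g G  ≡⟨ sumTo-agree-above (suc d) t d<t agree ⟩
    sumTo t g G + sumTo (suc d) f G  ∎)
  where open ≤-Reasoning

digit-<⇒sumTo-suc-< : ∀ {f g : CoeffFun} {G : ℕ → ℕ} k → sumTo k f G < G k → f k < g k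
  → sumTo (suc k) f G < sumTo (suc k) g G
digit-<⇒sumTo-suc-< {f} {g} {G} k low lt = begin-strict
  sumTo k f G + f k * G k  <⟨ +-monoˡ-< (f k * G k) low ⟩
  suc (f k) * G k          ≤⟨ *-monoˡ-≤ (G k) lt ⟩
  g k * G k                ≤⟨ m≤n+m (g k * G k) (sumTo k g G) ⟩
  sumTo k g G + g k * G k  ∎
  where open ≤-Reasoning

term≤sumTo : ∀ {f : CoeffFun} {G : ℕ → ℕ} t i → i < t → f i * G i ≤ sumTo t f G
term≤sumTo {f} {G} (suc t) i i<1+t with m≤n⇒m<n∨m≡n (≤-pred i<1+t)
... | inj₂ refl = m≤n+m _ _
... | inj₁ i<t  = ≤-trans (term≤sumTo t i i<t) (m≤m+n _ _)

sumTo-crossing : ∀ {f : CoeffFun} {G : ℕ → ℕ} t d → 0 < d → d ≤ sumTo t f G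
  → ∃ λ k → k < t × ∃ λ w → w < f k * G k × w + d ≡ sumTo (suc k) f G
sumTo-crossing zero d d>0 d≤0 = ⊥-elim (<⇒≱ d>0 d≤0)
sumTo-crossing {f} {G} (suc t) d d>0 d≤S with d ≤? sumTo t f G
... | yes d≤S' with sumTo-crossing t d d>0 d≤S'
...   | k , k<t , rest = k , m<n⇒m<1+n k<t , rest
sumTo-crossing {f} {G} (suc t) d d>0 d≤S | no d≰S' =
  t , n<1+n t , w , w<term , w+d≡S
  where
  w : ℕ
  w = sumTo (suc t) f G ∸ d
  w+d≡S : w + d ≡ sumTo (suc t) f G
  w+d≡S = m∸n+n≡m d≤S
  w<term : w < f t * G t
  w<term = +-cancelʳ-< d w (f t * G t)
    (subst₂ _<_ (sym w+d≡S) (+-comm d _) (+-monoˡ-< (f t * G t) (≰⇒> d≰S')))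

sumTo-remainder : ∀ {f : CoeffFun} {G : ℕ → ℕ} t {n} → n < sumTo t f G
  → ∃ λ k → k < t × ∃ λ w → w < f k * G k × n + sumTo (suc k) f G ≡ sumTo t f G + w
sumTo-remainder {f} {G} t {n} n<S with sumTo-crossing t (sumTo t f G ∸ n) (m<n⇒0<n∸m n<S) (m∸n≤m _ n)
... | k , k<t , w , w<term , w+d≡Sk = k , k<t , w , w<term , (begin
  n + sumTo (suc k) f G        ≡⟨ cong (n +_) w+d≡Sk ⟨
  n + (w + (sumTo t f G ∸ n))  ≡⟨ cong (n +_) (+-comm w _) ⟩
  n + ((sumTo t f G ∸ n) + w)  ≡⟨ +-assoc n _ w ⟨
  (n + (sumTo t f G ∸ n)) + w  ≡⟨ cong (_+ w) (m+[n∸m]≡n (<⇒≤ n<S)) ⟩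
  sumTo t f G + w              ∎)
  where open ≡-Reasoning

divMod-< : ∀ {w t h} .{{_ : NonZero h}} → w < t * h → ∃ λ v → v < t × ∃ λ r → r < h × w ≡ r + v * h
divMod-< {w} {t} {h} w<th = w / h , m<n*o⇒m/o<n w<th , w % h , m%n<n w h , m≡m%n+[m/n]*n w h

splice : ℕ → CoeffFun → ℕ → CoeffFun → CoeffFun
splice zero    g v f zero    = v
splice zero    g v f (suc i) = f (suc i)
splice (suc k) g v f zero    = g zero
splice (suc k) g v f (suc i) = splice k (λ x → g (suc x)) v (λ x → f (suc x)) i

splice-< : ∀ k g v f i → i < k → splice k g v f i ≡ g i
splice-< (suc k) g v f zero    _   = refl
splice-< (suc k) g v f (suc i) i<k = splice-< k _ v _ i (≤-pred i<k)

splice-≡ : ∀ k g v f → splice k g v f k ≡ v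
splice-≡ zero    g v f = refl
splice-≡ (suc k) g v f = splice-≡ k _ v _

splice-> : ∀ k g v f i → k < i → splice k g v f i ≡ f i
splice-> zero    g v f (suc i) _   = refl
splice-> (suc k) g v f (suc i) k<i = splice-> k _ v _ i (≤-pred k<i)

<ₐ-trichotomy : ∀ K {f g : CoeffFun} → (∀ j → K ≤ j → f j ≡ g j)
  → f <ₐ g ⊎ (∀ j → f j ≡ g j) ⊎ g <ₐ f
<ₐ-trichotomy zero    agree = inj₂ (inj₁ (λ j → agree j z≤n))
<ₐ-trichotomy (suc K) {f} {g} agree with <-cmp (f K) (g K)
... | tri< lt _ _ = inj₁ (K , lt , agree)
... | tri> _ _ gt = inj₂ (inj₂ (K , gt , λ j K<j → sym (agree j K<j)))
... | tri≈ _ eq _ = <ₐ-trichotomy K agree′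
  where
  agree′ : ∀ j → K ≤ j → f j ≡ g j
  agree′ j K≤j with m≤n⇒m<n∨m≡n K≤j
  ... | inj₁ K<j  = agree j K<j
  ... | inj₂ refl = eq

supports-agree : ∀ {K K'} {f g : CoeffFun} → SupportBelow K f → SupportBelow K' g
  → ∀ j → K ⊔ K' ≤ j → f j ≡ g j
supports-agree {K} {K'} supp supp' j K⊔K'≤j =
  trans (supp j (≤-trans (m≤m⊔n K K') K⊔K'≤j)) (sym (supp' j (≤-trans (m≤n⊔m K K') K⊔K'≤j)))

positive⇒below-support : ∀ {K d} {f : CoeffFun} → SupportBelow K f → 0 < f d → d < K
positive⇒below-support {K} {d} supp f>0 with d <? K
... | yes d<K = d<K
... | no  d≮K = ⊥-elim (<-irrefl (sym (supp d (≮⇒≥ d≮K))) f>0)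

minimal-witness : ∀ {P : ℕ → Set} → Decidable P → ∀ n → P n → ∃ λ c → P c × (∀ m → m < c → ¬ P m)
minimal-witness P? zero p = 0 , p , λ _ ()
minimal-witness P? (suc n) p with P? 0
... | yes p0 = 0 , p0 , λ _ ()
... | no ¬p0 with minimal-witness (λ m → P? (suc m)) n p
...   | c , pc , below = suc c , pc , λ { zero _ → ¬p0 ; (suc m) m<c → below m (≤-pred m<c) }

blockSum : List Blk → CoeffFun
blockSum bs i = sum (map (blkAt i) bs)

topOf : List Blk → ℕ
topOf []                  = 0
topOf ((_ , _ , b) ∷ bs) = suc b ⊔ topOf bs

∈⇒<topOf : ∀ bs {ζ a b} → (ζ , a , b) ∈ bs → b < topOf bs
∈⇒<topOf ((_ , _ , b) ∷ bs) (here refl) = m≤m⊔n (suc b) (topOf bs)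
∈⇒<topOf ((_ , _ , b) ∷ bs) (there mem) = ≤-trans (∈⇒<topOf bs mem) (m≤n⊔m (suc b) (topOf bs))

blockSum-zero : ∀ i bs → (∀ {ζ a b} → (ζ , a , b) ∈ bs → ζ i ≡ 0) → blockSum bs i ≡ 0
blockSum-zero i []       zero-at = refl
blockSum-zero i (_ ∷ bs) zero-at = cong₂ _+_ (zero-at (here refl)) (blockSum-zero i bs (zero-at ∘′ there))

disjoint-or-equal : ∀ {bs x y} → AllPairs DisjointBlk bs → x ∈ bs → y ∈ bs → x ≡ y ⊎ DisjointBlk x y
disjoint-or-equal (_ ∷ _)    (here refl) (here refl) = inj₁ refl
disjoint-or-equal (hd ∷ _)   (here refl) (there y∈) = inj₂ (All.lookup hd y∈)
disjoint-or-equal (hd ∷ _)   (there x∈)  (here refl) = inj₂ (swap (All.lookup hd x∈))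
disjoint-or-equal (_ ∷ rest) (there x∈)  (there y∈) = disjoint-or-equal rest x∈ y∈

module Collection (L : List ℕ) (valid : ValidList L) where

  θ : ℕ → CoeffFun
  θ = theta L

  θ-last-pos : ∀ m → 0 < θ (suc m) m
  θ-last-pos m = subst (0 <_) (sym (theta-last L m)) (beta-head-pos valid)

  -- Below position m, ε is a sum of L-blocks with disjoint supports inside [0, m), peeled off from
  -- the top.  A position j covered by no block counts as the proper block [j, j] with coefficient 0,
  -- which is allowed because θ^{j+1}_j = e₁ > 0.
  data Admissible (ε : CoeffFun) : ℕ → Set where
    empty   : Admissible ε 0
    maximal : ∀ {m} → (∀ j → j < suc m → ε j ≡ θ (suc m) j) → Admissible ε (suc m)
    proper  : ∀ {m k} → k ≤ m → (∀ j → k < j → j < suc m → ε j ≡ θ (suc m) j)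
            → ε k < θ (suc m) k → Admissible ε k → Admissible ε (suc m)

  admissible-cong : ∀ {f g : CoeffFun} {m} → (∀ j → j < m → f j ≡ g j) → Admissible f m → Admissible g m
  admissible-cong f≗g empty = empty
  admissible-cong f≗g (maximal top) = maximal (λ j j<m → trans (sym (f≗g j j<m)) (top j j<m))
  admissible-cong {m = suc m} f≗g (proper {k = k} k≤m top digit low) =
    proper k≤m (λ j k<j j<m → trans (sym (f≗g j j<m)) (top j k<j j<m))
      (subst (_< θ (suc m) k) (f≗g k (s≤s k≤m)) digit)
      (admissible-cong (λ j j<k → f≗g j (<-trans j<k (s≤s k≤m))) low)

  admissible-skip : ∀ {ε : CoeffFun} {m} → ε m ≡ 0 → Admissible ε m → Admissible ε (suc m)
  admissible-skip {m = m} εm≡0 adm =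
    proper ≤-refl (λ j m<j j<1+m → ⊥-elim (<⇒≱ m<j (≤-pred j<1+m)))
      (subst (_< θ (suc m) m) (sym εm≡0) (θ-last-pos m)) adm

  admissible-raise : ∀ {ε : CoeffFun} {m} → Admissible ε m → SupportBelow m ε → ∀ m' → m ≤ m' → Admissible ε m'
  admissible-raise adm supp m' m≤m' with m≤n⇒m<n∨m≡n m≤m'
  ... | inj₂ refl = adm
  admissible-raise adm supp (suc m') _ | inj₁ m<1+m' =
    admissible-skip (supp m' (≤-pred m<1+m')) (admissible-raise adm supp m' (≤-pred m<1+m'))

  block-outside : ∀ {ζ a b} → IsBlock L ζ a b → ∀ j → j < a ⊎ b < j → ζ j ≡ 0
  block-outside (maximal ζ≗θ)           j (inj₂ b<j) = trans (ζ≗θ j) (theta-≥ L b<j)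
  block-outside (proper a≤b top _ _)    j (inj₂ b<j) = trans (top j (≤-<-trans a≤b b<j)) (theta-≥ L b<j)
  block-outside (proper _ _ _ zero-low) j (inj₁ j<a) = zero-low j j<a

  blockSum-inside : ∀ {bs} → All (ValidBlk L) bs → AllPairs DisjointBlk bs → ∀ {ζ a b} → (ζ , a , b) ∈ bs
    → ∀ j → a ≤ j → j ≤ b → blockSum bs j ≡ ζ j
  blockSum-inside {(ζ , a , b) ∷ bs} (_ ∷ valids) (disj ∷ _) (here refl) j a≤j j≤b =
    trans (cong (ζ j +_) (blockSum-zero j bs others-zero)) (+-identityʳ (ζ j))
    where
    others-zero : ∀ {ζ' a' b'} → (ζ' , a' , b') ∈ bs → ζ' j ≡ 0
    others-zero mem with All.lookup disj mem
    ... | inj₁ b<a' = block-outside (All.lookup valids mem) j (inj₁ (≤-<-trans j≤b b<a'))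
    ... | inj₂ b'<a = block-outside (All.lookup valids mem) j (inj₂ (<-≤-trans b'<a a≤j))
  blockSum-inside {(_ , a₀ , b₀) ∷ _} (valid₀ ∷ valids) (disj ∷ disjs) (there mem) j a≤j j≤b =
    cong₂ _+_ (block-outside valid₀ j outside) (blockSum-inside valids disjs mem j a≤j j≤b)
    where
    outside : j < a₀ ⊎ b₀ < j
    outside with All.lookup disj mem
    ... | inj₁ b₀<a = inj₂ (<-≤-trans b₀<a a≤j)
    ... | inj₂ b<a₀ = inj₁ (≤-<-trans j≤b b<a₀)

  SplitsAt : List Blk → ℕ → Set
  SplitsAt bs m = ∀ {ζ a b} → (ζ , a , b) ∈ bs → b < m ⊎ m ≤ a

  block-start-splits : ∀ {bs ζ a b} → AllPairs DisjointBlk bs → (ζ , a , b) ∈ bs → a ≤ b → SplitsAt bs a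
  block-start-splits disjs mem a≤b mem' with disjoint-or-equal disjs mem mem'
  ... | inj₁ refl       = inj₂ ≤-refl
  ... | inj₂ (inj₁ b<a') = inj₂ (≤-trans a≤b (<⇒≤ b<a'))
  ... | inj₂ (inj₂ b'<a) = inj₁ b'<a

  splits-uncovered : ∀ {bs m} → SplitsAt bs (suc m) → (∀ {ζ a b} → (ζ , a , b) ∈ bs → b ≢ m)
    → ∀ {ζ a b} → (ζ , a , b) ∈ bs → b < m ⊎ m < a
  splits-uncovered splits none mem with splits mem
  ... | inj₂ m<a = inj₂ m<a
  ... | inj₁ b<1+m with m≤n⇒m<n∨m≡n (≤-pred b<1+m)
  ...   | inj₁ b<m = inj₁ b<m
  ...   | inj₂ b≡m = ⊥-elim (none mem b≡m)

  blocks-admissible : ∀ {ε : CoeffFun} {bs} → All (ValidBlk L) bs → AllPairs DisjointBlk bs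
    → (∀ i → ε i ≡ blockSum bs i) → ∀ m → SplitsAt bs m → Admissible ε m
  blocks-admissible {ε} {bs} valids disjs ε≗ = <-rec (λ m → SplitsAt bs m → Admissible ε m) step
    where
    covered : ∀ {ζ a b} → (ζ , a , b) ∈ bs → ∀ j → a ≤ j → j ≤ b → ε j ≡ ζ j
    covered mem j a≤j j≤b = trans (ε≗ j) (blockSum-inside valids disjs mem j a≤j j≤b)

    step : ∀ m → (∀ {k} → k < m → SplitsAt bs k → Admissible ε k) → SplitsAt bs m → Admissible ε m
    step zero    _   _      = empty
    step (suc m) rec splits with any? (λ blk → proj₂ (proj₂ blk) ≟ m) bs
    ... | yes ends with find ends
    ...   | (ζ , a , .m) , mem , refl with All.lookup valids mem
    ...     | maximal ζ≗θ = maximal (λ j j<1+m → trans (covered mem j z≤n (≤-pred j<1+m)) (ζ≗θ j))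
    ...     | proper a≤m top digit _ =
      proper a≤m (λ j a<j j<1+m → trans (covered mem j (<⇒≤ a<j) (≤-pred j<1+m)) (top j a<j))
        (subst (_< θ (suc m) a) (sym (covered mem a ≤-refl a≤m)) digit)
        (rec (s≤s a≤m) (block-start-splits disjs mem a≤m))
    step (suc m) rec splits | no none =
      admissible-skip (trans (ε≗ m) (blockSum-zero m bs uncovered-zero)) (rec (n<1+n m) splits′)
      where
      uncovered : ∀ {ζ a b} → (ζ , a , b) ∈ bs → b < m ⊎ m < a
      uncovered = splits-uncovered splits (λ mem b≡m → none (lose mem b≡m))
      uncovered-zero : ∀ {ζ a b} → (ζ , a , b) ∈ bs → ζ m ≡ 0
      uncovered-zero mem = block-outside (All.lookup valids mem) m (swap (uncovered mem))
      splits′ : SplitsAt bs m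
      splits′ mem with uncovered mem
      ... | inj₁ b<m = inj₁ b<m
      ... | inj₂ m<a = inj₂ (<⇒≤ m<a)

  InColl⇒Admissible : ∀ {ε : CoeffFun} → InColl L ε → ∃ λ T → Admissible ε T × SupportBelow T ε
  InColl⇒Admissible {ε} (bs , valids , disjs , ε≗) =
    topOf bs , blocks-admissible valids disjs ε≗ (topOf bs) (inj₁ ∘′ ∈⇒<topOf bs) , above-zero
    where
    above-zero : SupportBelow (topOf bs) ε
    above-zero i top≤i = trans (ε≗ i) (blockSum-zero i bs (λ mem →
      block-outside (All.lookup valids mem) i (inj₂ (<-≤-trans (∈⇒<topOf bs mem) top≤i))))

  BlocksBelow : CoeffFun → ℕ → List Blk → Set
  BlocksBelow ε m bs = All (ValidBlk L) bs × AllPairs DisjointBlk bs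
    × (∀ {ζ a b} → (ζ , a , b) ∈ bs → b < m)
    × (∀ i → i < m → ε i ≡ blockSum bs i) × (∀ i → m ≤ i → blockSum bs i ≡ 0)

  admissible-blocks : ∀ {ε : CoeffFun} {m} → Admissible ε m → ∃ (BlocksBelow ε m)
  admissible-blocks empty = [] , [] , [] , (λ ()) , (λ _ ()) , (λ _ _ → refl)
  admissible-blocks (maximal {m} top) =
    (θ (suc m) , 0 , m) ∷ [] , maximal (λ _ → refl) ∷ [] , [] ∷ []
    , (λ { (here refl) → n<1+n m })
    , (λ i i<1+m → trans (top i i<1+m) (sym (+-identityʳ _)))
    , (λ i m<i → trans (+-identityʳ _) (theta-≥ L m<i))
  admissible-blocks {ε} (proper {m} {k} k≤m top digit low) with admissible-blocks low
  ... | bs , valids , disjs , below , agree , zero-above =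
    (ζ , k , m) ∷ bs
    , proper k≤m (λ j k<j → splice-> k _ (ε k) _ j k<j) (subst (_< θ (suc m) k) (sym (splice-≡ k _ (ε k) _)) digit)
        (λ j j<k → splice-< k _ (ε k) _ j j<k)
      ∷ valids
    , All.tabulate (inj₂ ∘′ below) ∷ disjs
    , (λ { (here refl) → n<1+n m ; (there mem) → <-trans (below mem) (s≤s k≤m) })
    , agree′
    , λ i m<i → cong₂ _+_ (trans (splice-> k _ (ε k) _ i (<-≤-trans (s≤s k≤m) m<i)) (theta-≥ L m<i))
                          (zero-above i (≤-trans k≤m (<⇒≤ m<i)))
    where
    ζ : CoeffFun
    ζ = splice k (λ _ → 0) (ε k) (θ (suc m))
    agree′ : ∀ i → i < suc m → ε i ≡ ζ i + blockSum bs i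
    agree′ i i<1+m with <-cmp i k
    ... | tri< i<k _ _ = trans (agree i i<k) (cong (_+ blockSum bs i) (sym (splice-< k _ (ε k) _ i i<k)))
    ... | tri≈ _ refl _ = sym (trans (cong₂ _+_ (splice-≡ k _ (ε k) _) (zero-above k ≤-refl)) (+-identityʳ (ε k)))
    ... | tri> _ _ k<i = sym (trans (cong₂ _+_ (splice-> k _ (ε k) _ i k<i) (zero-above i (<⇒≤ k<i)))
                                     (trans (+-identityʳ _) (sym (top i k<i i<1+m))))

  Admissible⇒InColl : ∀ {ε : CoeffFun} {m} → Admissible ε m → SupportBelow m ε → InColl L ε
  Admissible⇒InColl {ε} {m} adm supp with admissible-blocks adm
  ... | bs , valids , disjs , _ , agree , zero-above = bs , valids , disjs , ε≗
    where
    ε≗ : ∀ i → ε i ≡ blockSum bs i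
    ε≗ i with i <? m
    ... | yes i<m = agree i i<m
    ... | no  i≮m = trans (supp i (≮⇒≥ i≮m)) (sym (zero-above i (≮⇒≥ i≮m)))

module Zeckendorf (L : List ℕ) (valid : ValidList L) (H : ℕ → ℕ) (fundamental : Fundamental L H) where
  open Collection L valid public

  H-suc : ∀ m → H (suc m) ≡ suc (sumTo (suc m) (θ (suc m)) H)
  H-suc m = proj₂ fundamental (suc m) (s≤s z≤n)

  H-pos : ∀ m → 0 < H m
  H-pos zero    = subst (0 <_) (sym (proj₁ fundamental)) z<s
  H-pos (suc m) = subst (0 <_) (sym (H-suc m)) z<s

  n<H : ∀ n → n < H n
  n<H zero    = H-pos zero
  n<H (suc n) = begin-strict
    suc n                                              ≤⟨ n<H n ⟩
    H n                                                ≡⟨ *-identityˡ (H n) ⟨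
    1 * H n                                            ≤⟨ *-monoˡ-≤ (H n) (θ-last-pos n) ⟩
    θ (suc n) n * H n                                  ≤⟨ m≤n+m _ _ ⟩
    sumTo n (θ (suc n)) H + θ (suc n) n * H n          <⟨ n<1+n _ ⟩
    suc (sumTo (suc n) (θ (suc n)) H)                  ≡⟨ H-suc n ⟨
    H (suc n)                                          ∎
    where open ≤-Reasoning

  proper-value-< : ∀ {ε : CoeffFun} {m k} → k ≤ m → (∀ j → k < j → j < suc m → ε j ≡ θ (suc m) j)
    → ε k < θ (suc m) k → sumTo k ε H < H k → sumTo (suc m) ε H < sumTo (suc m) (θ (suc m)) H
  proper-value-< {k = k} k≤m top digit low =
    sumTo-suc-<⇒sumTo-< k _ (s≤s k≤m) top (digit-<⇒sumTo-suc-< k low digit)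

  admissible-value-< : ∀ {ε : CoeffFun} {m} → Admissible ε m → sumTo m ε H < H m
  admissible-value-< empty = H-pos 0
  admissible-value-< {ε} (maximal {m} top) =
    subst (sumTo (suc m) ε H <_) (sym (H-suc m)) (s≤s (≤-reflexive (sumTo-cong (suc m) top)))
  admissible-value-< {ε} (proper {m} k≤m top digit low) =
    subst (sumTo (suc m) ε H <_) (sym (H-suc m))
      (m<n⇒m<1+n (proper-value-< k≤m top digit (admissible-value-< low)))

  θ-segment-not-<ₐ-proper : ∀ {ε ε' : CoeffFun} {m k} → k ≤ m → (∀ j → k ≤ j → j < suc m → ε j ≡ θ (suc m) j)
    → (∀ j → k < j → j < suc m → ε' j ≡ θ (suc m) j) → ε' k < θ (suc m) k
    → ∀ d → d < suc m → ε d < ε' d → (∀ j → d < j → ε j ≡ ε' j) → ⊥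
  θ-segment-not-<ₐ-proper {ε} {ε'} {m} {k} k≤m seg top digit d d<1+m lt agree with <-cmp d k
  ... | tri< d<k _ _ = <-irrefl (trans (sym (agree k d<k)) (seg k ≤-refl (s≤s k≤m))) digit
  ... | tri≈ _ refl _ = <-asym lt (subst (ε' d <_) (sym (seg d ≤-refl d<1+m)) digit)
  ... | tri> _ _ k<d = <-irrefl (trans (seg d (<⇒≤ k<d) d<1+m) (sym (top d k<d d<1+m))) lt

  θ-tops-value-< : ∀ {ε ε' : CoeffFun} {m k} → k ≤ m → (∀ j → k < j → j < suc m → ε j ≡ θ (suc m) j)
    → (∀ j → k < j → j < suc m → ε' j ≡ θ (suc m) j)
    → sumTo (suc k) ε H < sumTo (suc k) ε' H → sumTo (suc m) ε H < sumTo (suc m) ε' H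
  θ-tops-value-< {k = k} k≤m top top' =
    sumTo-suc-<⇒sumTo-< k _ (s≤s k≤m) (λ j k<j j<m → trans (top j k<j j<m) (sym (top' j k<j j<m)))

  admissible-value-strictMono : ∀ {ε ε' : CoeffFun} {m} → Admissible ε m → Admissible ε' m
    → ∀ d → d < m → ε d < ε' d → (∀ j → d < j → ε j ≡ ε' j) → sumTo m ε H < sumTo m ε' H
  admissible-value-strictMono (maximal top) (maximal top') d d<m lt _ =
    ⊥-elim (<-irrefl (trans (top d d<m) (sym (top' d d<m))) lt)
  admissible-value-strictMono {ε} {ε'} (maximal {m} top) (proper {k = k} k≤m top' digit' _) d d<m lt agree =
    ⊥-elim (θ-segment-not-<ₐ-proper {ε} {ε'} {m} {k} k≤m (λ j _ → top j) top' digit' d d<m lt agree)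
  admissible-value-strictMono (proper {m} k≤m top digit low) (maximal top') _ _ _ _ =
    <-≤-trans (proper-value-< k≤m top digit (admissible-value-< low)) (≤-reflexive (sym (sumTo-cong (suc m) top')))
  admissible-value-strictMono {ε} (proper {m} {k} k≤m top digit low) (proper {k = k'} k'≤m top' digit' low')
    d d<m lt agree with <-cmp k k'
  ... | tri< k<k' _ _ =
    ⊥-elim (θ-segment-not-<ₐ-proper {ε} k'≤m (λ j k'≤j → top j (<-≤-trans k<k' k'≤j)) top' digit' d d<m lt agree)
  ... | tri> _ _ k'<k = θ-tops-value-< k≤m top (λ j k<j → top' j (<-trans k'<k k<j))
    (digit-<⇒sumTo-suc-< k (admissible-value-< low) (subst (ε k <_) (sym (top' k k'<k (s≤s k≤m))) digit))
  ... | tri≈ _ refl _ with <-cmp d k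
  ...   | tri> _ _ k<d  = ⊥-elim (<-irrefl (trans (top d k<d d<m) (sym (top' d k<d d<m))) lt)
  ...   | tri≈ _ refl _ = θ-tops-value-< k≤m top top' (digit-<⇒sumTo-suc-< k (admissible-value-< low) lt)
  ...   | tri< d<k _ _  = θ-tops-value-< k≤m top top'
    (+-mono-<-≤ (admissible-value-strictMono low low' d d<k lt agree) (≤-reflexive (cong (_* H k) (agree k d<k))))

  record Representation (m n : ℕ) : Set where
    field
      coefficients : CoeffFun
      admissible   : Admissible coefficients m
      supported    : SupportBelow m coefficients
      value        : sumTo m coefficients H ≡ n

  splice-representation : ∀ {m k r} → k ≤ m → (v : ℕ) → v < θ (suc m) k → Representation k r
    → Σ CoeffFun λ ε → Admissible ε (suc m) × SupportBelow (suc m) ε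
      × sumTo (suc m) ε H + sumTo (suc k) (θ (suc m)) H ≡ sumTo (suc m) (θ (suc m)) H + (r + v * H k)
  splice-representation {m} {k} {r} k≤m v v<θ R = ε , adm , supp , value-eq
    where
    open Representation R renaming (coefficients to ρ)
    ε : CoeffFun
    ε = splice k ρ v (θ (suc m))
    top : ∀ j → k < j → j < suc m → ε j ≡ θ (suc m) j
    top j k<j _ = splice-> k ρ v _ j k<j
    adm : Admissible ε (suc m)
    adm = proper k≤m top (subst (_< θ (suc m) k) (sym (splice-≡ k ρ v _)) v<θ)
            (admissible-cong (λ j j<k → sym (splice-< k ρ v _ j j<k)) admissible)
    supp : SupportBelow (suc m) ε
    supp i m<i = trans (splice-> k ρ v _ i (<-≤-trans (s≤s k≤m) m<i)) (theta-≥ L m<i)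
    value-eq : sumTo (suc m) ε H + sumTo (suc k) (θ (suc m)) H ≡ sumTo (suc m) (θ (suc m)) H + (r + v * H k)
    value-eq = begin
      sumTo (suc m) ε H + sumTo (suc k) (θ (suc m)) H  ≡⟨ sumTo-agree-above (suc k) (suc m) (s≤s k≤m) top ⟩
      sumTo (suc m) (θ (suc m)) H + (sumTo k ε H + ε k * H k)
        ≡⟨ cong (sumTo (suc m) (θ (suc m)) H +_) (cong₂ _+_
             (trans (sumTo-cong k (λ j j<k → splice-< k ρ v _ j j<k)) value)
             (cong (_* H k) (splice-≡ k ρ v _))) ⟩
      sumTo (suc m) (θ (suc m)) H + (r + v * H k)      ∎
      where open ≡-Reasoning

  representation : ∀ m n → n < H m → Representation m n
  representation = <-rec (λ m → ∀ n → n < H m → Representation m n) step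
    where
    step : ∀ m → (∀ {k} → k < m → ∀ n → n < H k → Representation k n) → ∀ n → n < H m → Representation m n
    step zero _ n n<1 = record
      { coefficients = λ _ → 0 ; admissible = empty ; supported = λ _ _ → refl
      ; value = sym (n<1⇒n≡0 (subst (n <_) (proj₁ fundamental) n<1)) }
    step (suc m) rec n n<H with m≤n⇒m<n∨m≡n (≤-pred (subst (n <_) (H-suc m) n<H))
    ... | inj₂ refl = record
      { coefficients = θ (suc m) ; admissible = maximal (λ _ _ → refl) ; supported = λ _ → theta-≥ L ; value = refl }
    -- n = Σ_{j>k} θ^{m+1}_j H_j + w with w < θ^{m+1}_k H_k; dividing w by H_k gives the coefficient
    -- at k and a remainder that is represented below k.
    ... | inj₁ n<U with sumTo-remainder (suc m) n<U
    ...   | k , k<1+m , w , w<θH , n+S≡U+w with divMod-< {{>-nonZero (H-pos k)}} w<θH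
    ...     | v , v<θ , r , r<H , w≡r+vH with splice-representation (≤-pred k<1+m) v v<θ (rec k<1+m r r<H)
    ...       | ε , adm , supp , ε+S≡U+r+vH = record
      { coefficients = ε ; admissible = adm ; supported = supp
      ; value = +-cancelʳ-≡ _ _ _ (trans ε+S≡U+r+vH (trans (cong (_ +_) (sym w≡r+vH)) (sym n+S≡U+w))) }

  <ₐ⇒value< : ∀ {ε ε' : CoeffFun} {K K'} → InColl L ε → InColl L ε' → SupportBelow K ε → SupportBelow K' ε'
    → ε <ₐ ε' → sumTo K ε H < sumTo K' ε' H
  <ₐ⇒value< {ε} {ε'} {K} {K'} inE inE' supp supp' (d , lt , agree)
    with InColl⇒Admissible inE | InColl⇒Admissible inE'
  ... | T , adm , suppT | T' , adm' , suppT' = begin-strict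
    sumTo K ε H           ≡⟨ sumTo-bound-irrelevant supp (λ i B≤i → suppT i (≤-trans (m≤m⊔n T T') B≤i)) ⟩
    sumTo (T ⊔ T') ε H    <⟨ admissible-value-strictMono (raise adm suppT (m≤m⊔n T T')) (raise adm' suppT' (m≤n⊔m T T'))
                               d d<B lt agree ⟩
    sumTo (T ⊔ T') ε' H   ≡⟨ sumTo-bound-irrelevant (λ i B≤i → suppT' i (≤-trans (m≤n⊔m T T') B≤i)) supp' ⟩
    sumTo K' ε' H         ∎
    where
    open ≤-Reasoning
    raise : ∀ {f : CoeffFun} {t} → Admissible f t → SupportBelow t f → t ≤ T ⊔ T' → Admissible f (T ⊔ T')
    raise adm supp t≤B = admissible-raise adm supp (T ⊔ T') t≤B
    d<B : d < T ⊔ T'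
    d<B = <-≤-trans (positive⇒below-support suppT' (≤-<-trans z≤n lt)) (m≤n⊔m T T')

  value<⇒<ₐ : ∀ {ε ε' : CoeffFun} {K K'} → InColl L ε → InColl L ε' → SupportBelow K ε → SupportBelow K' ε'
    → sumTo K ε H < sumTo K' ε' H → ε <ₐ ε'
  value<⇒<ₐ {ε} {ε'} {K} {K'} inE inE' supp supp' lt with <ₐ-trichotomy (K ⊔ K') (supports-agree supp supp')
  ... | inj₁ ε<ε'          = ε<ε'
  ... | inj₂ (inj₂ ε'<ε)   = ⊥-elim (<-asym lt (<ₐ⇒value< inE' inE supp' supp ε'<ε))
  ... | inj₂ (inj₁ ε≗ε')   = ⊥-elim (<-irrefl same-value lt)
    where
    same-value : sumTo K ε H ≡ sumTo K' ε' H
    same-value = trans (sumTo-cong K (λ j _ → ε≗ε' j))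
      (sumTo-bound-irrelevant (λ j K≤j → trans (sym (ε≗ε' j)) (supp j K≤j)) supp')

  value≡⇒≗ : ∀ {ε ε' : CoeffFun} {K K'} → InColl L ε → InColl L ε' → SupportBelow K ε → SupportBelow K' ε'
    → sumTo K ε H ≡ sumTo K' ε' H → ∀ j → ε j ≡ ε' j
  value≡⇒≗ {K = K} {K'} inE inE' supp supp' eq with <ₐ-trichotomy (K ⊔ K') (supports-agree supp supp')
  ... | inj₁ ε<ε'        = ⊥-elim (<-irrefl eq (<ₐ⇒value< inE inE' supp supp' ε<ε'))
  ... | inj₂ (inj₂ ε'<ε) = ⊥-elim (<-irrefl (sym eq) (<ₐ⇒value< inE' inE supp' supp ε'<ε))
  ... | inj₂ (inj₁ ε≗ε') = ε≗ε'

  zeckendorf : ∀ n → Representation n n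
  zeckendorf n = representation n n (n<H n)

  open Representation

  digits : ℕ → CoeffFun
  digits n = zeckendorf n .coefficients

  digits-supported : ∀ n → SupportBelow n (digits n)
  digits-supported n = zeckendorf n .supported

  digits-value : ∀ n → sumTo n (digits n) H ≡ n
  digits-value n = zeckendorf n .value

  digits-inColl : ∀ n → InColl L (digits n)
  digits-inColl n = Admissible⇒InColl (zeckendorf n .admissible) (digits-supported n)

  inColl-supported : ∀ {ε : CoeffFun} → InColl L ε → ∃ λ T → SupportBelow T ε
  inColl-supported inE with InColl⇒Admissible inE
  ... | T , _ , supp = T , supp

  ≗digits-value : ∀ {ρ : CoeffFun} {T} → InColl L ρ → SupportBelow T ρ → ∀ j → ρ j ≡ digits (sumTo T ρ H) j
  ≗digits-value {ρ} {T} inR supp =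
    value≡⇒≗ inR (digits-inColl p) supp (digits-supported p) (sym (digits-value p))
    where
    p : ℕ
    p = sumTo T ρ H

  digits-<ₐ⇒< : ∀ {ρ : CoeffFun} {T} n → InColl L ρ → SupportBelow T ρ → digits n <ₐ ρ → n < sumTo T ρ H
  digits-<ₐ⇒< n inR supp lt =
    subst (_< _) (digits-value n) (<ₐ⇒value< (digits-inColl n) inR (digits-supported n) supp lt)

  <ₐ-digits⇒< : ∀ {ρ : CoeffFun} {T} n → InColl L ρ → SupportBelow T ρ → ρ <ₐ digits n → sumTo T ρ H < n
  <ₐ-digits⇒< n inR supp lt =
    subst (_ <_) (digits-value n) (<ₐ⇒value< inR (digits-inColl n) supp (digits-supported n) lt)

  digits-<ₐ : ∀ {n n'} → n < n' → digits n <ₐ digits n'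
  digits-<ₐ {n} {n'} n<n' = value<⇒<ₐ (digits-inColl n) (digits-inColl n') (digits-supported n) (digits-supported n')
    (subst₂ _<_ (sym (digits-value n)) (sym (digits-value n')) n<n')

  digits-suc-isBar : ∀ n → IsBar L (digits n) (digits (suc n))
  digits-suc-isBar n = digits-inColl (suc n) , digits-<ₐ (n<1+n n) , between
    where
    between : ∀ ρ → InColl L ρ → digits n <ₐ ρ → ¬ (ρ <ₐ digits (suc n))
    between ρ inR n<ρ ρ<1+n with inColl-supported inR
    ... | T , supp = <-irrefl refl (<-≤-trans (<ₐ-digits⇒< (suc n) inR supp ρ<1+n) (digits-<ₐ⇒< n inR supp n<ρ))

module Duality (L L̃ : List ℕ) (valid : ValidList L) (valid~ : ValidList L̃)
  (H H̃ : ℕ → ℕ) (fundamental : Fundamental L H) (fundamental~ : Fundamental L̃ H̃)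
  (E⊆Ẽ : ∀ ε → InColl L ε → InColl L̃ ε) where

  module E = Zeckendorf L valid H fundamental
  module Ẽ = Zeckendorf L̃ valid~ H̃ fundamental~
  open E using (digits; digits-inColl; digits-supported; digits-value)

  transfer : ℕ → ℕ
  transfer n = sumTo n (digits n) H̃

  transfer-strictMono : ∀ {n n'} → n < n' → transfer n < transfer n'
  transfer-strictMono {n} {n'} n<n' =
    Ẽ.<ₐ⇒value< (E⊆Ẽ _ (digits-inColl n)) (E⊆Ẽ _ (digits-inColl n')) (digits-supported n) (digits-supported n')
      (E.digits-<ₐ n<n')

  transfer-mono : ∀ {n n'} → n ≤ n' → transfer n ≤ transfer n'
  transfer-mono n≤n' with m≤n⇒m<n∨m≡n n≤n'
  ... | inj₁ n<n' = <⇒≤ (transfer-strictMono n<n')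
  ... | inj₂ refl = ≤-refl

  transfer-injective : ∀ {n n'} → transfer n ≡ transfer n' → n ≡ n'
  transfer-injective {n} {n'} eq with <-cmp n n'
  ... | tri< n<n' _ _ = ⊥-elim (<-irrefl eq (transfer-strictMono n<n'))
  ... | tri≈ _ n≡n' _ = n≡n'
  ... | tri> _ _ n'<n = ⊥-elim (<-irrefl (sym eq) (transfer-strictMono n'<n))

  n≤transfer : ∀ n → n ≤ transfer n
  n≤transfer zero    = z≤n
  n≤transfer (suc n) = ≤-<-trans (n≤transfer n) (transfer-strictMono (n<1+n n))

  transfer-value : ∀ {ρ : CoeffFun} {T} → InColl L ρ → SupportBelow T ρ → sumTo T ρ H̃ ≡ transfer (sumTo T ρ H)
  transfer-value {ρ} {T} inR supp =
    trans (sumTo-cong T (λ j _ → ρ≗)) (sumTo-bound-irrelevant digits-supp-T (digits-supported p))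
    where
    p : ℕ
    p = sumTo T ρ H
    ρ≗ : ∀ {j} → ρ j ≡ digits p j
    ρ≗ {j} = E.≗digits-value inR supp j
    digits-supp-T : SupportBelow T (digits p)
    digits-supp-T j T≤j = trans (sym ρ≗) (supp j T≤j)

  module _ (μ : CoeffFun) (inμ : InColl L̃ μ) (N : ℕ) (suppμ : SupportBelow N μ) where

    x : ℕ
    x = sumTo N μ H̃

    -- c is both z(x) and the H-value of μ̄.
    threshold : ∃ λ c → x ≤ transfer c × (∀ n → n < c → ¬ (x ≤ transfer n))
    threshold = minimal-witness (λ n → x ≤? transfer n) x (n≤transfer x)

    c : ℕ
    c = proj₁ threshold

    <c⇒transfer< : ∀ {n} → n < c → transfer n < x
    <c⇒transfer< {n} n<c = ≰⇒> (proj₂ (proj₂ threshold) n n<c)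

    transfer<⇒<c : ∀ {n} → transfer n < x → n < c
    transfer<⇒<c {n} lt with n <? c
    ... | yes n<c = n<c
    ... | no  n≮c = ⊥-elim (<⇒≱ lt (≤-trans (proj₁ (proj₂ threshold)) (transfer-mono (≮⇒≥ n≮c))))

    <ₐμ⇒<c : ∀ {ρ : CoeffFun} {T} → InColl L ρ → SupportBelow T ρ → ρ <ₐ μ → sumTo T ρ H < c
    <ₐμ⇒<c inR supp ρ<μ =
      transfer<⇒<c (subst (_< x) (transfer-value inR supp) (Ẽ.<ₐ⇒value< (E⊆Ẽ _ inR) inμ supp suppμ ρ<μ))

    <c⇒<ₐμ : ∀ {ρ : CoeffFun} {T} → InColl L ρ → SupportBelow T ρ → sumTo T ρ H < c → ρ <ₐ μ
    <c⇒<ₐμ inR supp p<c =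
      Ẽ.value<⇒<ₐ (E⊆Ẽ _ inR) inμ supp suppμ (subst (_< x) (sym (transfer-value inR supp)) (<c⇒transfer< p<c))

    digits-isCheck : ∀ {n} → c ≡ suc n → IsCheck L μ (digits n)
    digits-isCheck {n} c≡1+n = digits-inColl n , digits<μ , largest
      where
      digits<μ : digits n <ₐ μ
      digits<μ = <c⇒<ₐμ (digits-inColl n) (digits-supported n)
        (subst₂ _<_ (sym (digits-value n)) (sym c≡1+n) (n<1+n n))
      largest : ∀ ρ → InColl L ρ → ρ <ₐ μ → ¬ (digits n <ₐ ρ)
      largest ρ inR ρ<μ n<ρ with E.inColl-supported inR
      ... | T , supp = <⇒≱ (E.digits-<ₐ⇒< n inR supp n<ρ) (≤-pred (subst (_ <_) c≡1+n (<ₐμ⇒<c inR supp ρ<μ)))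

    count : CountIs (RepBy L H̃) x c
    count = map transfer (upTo c) , Unique.map⁺ transfer-injective (Unique.upTo⁺ c) , sound , complete
          , trans (length-map transfer (upTo c)) (length-upTo c)
      where
      sound : ∀ n → n ∈ map transfer (upTo c) → n < x × RepBy L H̃ n
      sound n mem with ∈-map⁻ transfer mem
      ... | k , k∈ , refl = <c⇒transfer< (∈-upTo⁻ k∈) , digits k , digits-inColl k , k , digits-supported k , refl
      complete : ∀ n → n < x → RepBy L H̃ n → n ∈ map transfer (upTo c)
      complete n n<x (ε , inE , K , supp , refl) =
        subst (_∈ _) (sym (transfer-value inE supp))
          (∈-map⁺ transfer (∈-upTo⁺ (transfer<⇒<c {sumTo K ε H} (subst (_< x) (transfer-value inE supp) n<x))))

    x-pos : ∀ {i} → μ i ≢ 0 → 0 < x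
    x-pos {i} μi≢0 = begin-strict
      0            <⟨ Ẽ.H-pos i ⟩
      H̃ i          ≤⟨ m≤n*m (H̃ i) (μ i) {{≢-nonZero μi≢0}} ⟩
      μ i * H̃ i    ≤⟨ term≤sumTo N i (positive⇒below-support suppμ (n≢0⇒n>0 μi≢0)) ⟩
      x            ∎
      where open ≤-Reasoning

    duality : ∀ {i} → μ i ≢ 0 → ∃ λ ν → ∃ λ ν' → IsCheck L μ ν × IsBar L ν ν'
      × ∃ λ M → SupportBelow M ν' × CountIs (RepBy L H̃) x (sumTo M ν' H)
    duality μi≢0 with c in c≡
    ... | zero = ⊥-elim (<⇒≱ (x-pos μi≢0) (subst (λ n → x ≤ transfer n) c≡ (proj₁ (proj₂ threshold))))
    ... | suc n = digits n , digits (suc n) , digits-isCheck c≡ , E.digits-suc-isBar n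
      , suc n , digits-supported (suc n) , subst (CountIs (RepBy L H̃) x) (trans c≡ (sym (digits-value (suc n)))) count

-- Only the inclusion 𝓔 ⊆ 𝓔̃ is used.
theorem3p9 : (L L̃ : List ℕ) → ValidList L → ValidList L̃
  → (H H̃ : ℕ → ℕ) → Fundamental L H → Fundamental L̃ H̃
  → (∀ μ → InColl L μ → InColl L̃ μ)
  → (∃ λ μ → InColl L̃ μ × ¬ InColl L μ)
  → (μ : CoeffFun) → InColl L̃ μ → (∃ λ i → μ i ≢ 0)
  → (N : ℕ) → SupportBelow N μ
  → ∃ λ ν → ∃ λ ν' → IsCheck L μ ν × IsBar L ν ν'
      × ∃ λ M → SupportBelow M ν'
        × CountIs (RepBy L H̃) (sumTo N μ H̃) (sumTo M ν' H)
theorem3p9 L L̃ valid valid~ H H̃ fundamental fundamental~ E⊆Ẽ _ μ inμ (_ , μi≢0) N suppμ =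
  Duality.duality L L̃ valid valid~ H H̃ fundamental fundamental~ E⊆Ẽ μ inμ N suppμ μi≢0
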